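{- Let $H$ be a connected imperfect graph with no induced $K_3$ and no induced $P_2\cup P_3$, with the setup of the context, and suppose $S_2\ne\emptyset$. Then: (1) If $B_i,B_{i+2}\ne\emptyset$ and $[B_i\cup B_{i+2},S_2]\ne\emptyset$ for some $i$, then $|B_i|=|B_{i+2}|=1$ and there is a vertex $z\in S_2$ with $N(B_i)\cap S_2=N(B_{i+2})\cap S_2=\{z\}$. (2) If $b_i\in B_i$ and $b_{i+1}\in B_{i+1}$ are nonadjacent for some $i$, then either neither $b_i$ nor $b_{i+1}$ has a neighbor in $S_2$, or there is $z\in S_2$ with $N(b_i)\cap S_2=N(b_{i+1})\cap S_2=\{z\}$. (3) If ($h_B=2$ and $B_i,B_{i+2}\ne\emptyset$ for some $i$), or ($B_{i-1},B_i,B_{i+2}\ne\emptyset$ for some $i$), then $|B_j|\le1$ for every $j$, $\bigcup_{j=1}^5B_j$ is an independent set, and $S_2=\{z\}$ for a single vertex $z$ which is adjacent to every vertex of $\bigcup_{j=1}^5B_j$.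
   Context: $P_2\cup P_3$ is the disjoint union of a path on 2 vertices and a path on 3 vertices. Such $H$ contains an induced 5-cycle. Setup: fix an induced 5-cycle with vertices $v_1,\dots,v_5$ in cyclic order, indices mod 5, $S_0=\{v_1,\dots,v_5\}$; $S_k=\{x\notin S_0:\text{distance from }x\text{ to }S_0\text{ is }k\}$; $A_i=\{x\in S_1:N(x)\cap S_0=\{v_i\}\}$, $B_i=\{x\in S_1:N(x)\cap S_0=\{v_{i-1},v_{i+1}\}\}$; $h_B$ is the number of nonempty sets among $B_1,\dots,B_5$. $[S,T]$ is the set of edges between $S$ and $T$; $N(S)$ is the set of vertices outside $S$ with a neighbor in $S$. -}

module Defs where

open import Data.Nat using (ℕ; zero; suc; _≤_; _<_)
open import Data.Fin using (Fin; zero; suc)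
open import Data.Fin.Subset using (Subset; _∈_; ∣_∣)
open import Data.Bool using (Bool; true; false; T; _∨_)
open import Data.Product using (Σ; ∃; _×_; _,_)
open import Data.Sum using (_⊎_)
open import Relation.Nullary using (¬_)
open import Relation.Binary using (Decidable)
open import Relation.Binary.PropositionalEquality using (_≡_; _≢_)

record Graph : Set₁ where
  field
    n      : ℕ
    Adj    : Fin n → Fin n → Set
    adj?   : Decidable Adj
    sym    : ∀ {x y} → Adj x y → Adj y x
    irrefl : ∀ {x} → ¬ Adj x x

-- Indices mod 5 on Fin 5 (zero plays the role of index 1 in the paper).
next : Fin 5 → Fin 5
next zero = suc zero
next (suc zero) = suc (suc zero)
next (suc (suc zero)) = suc (suc (suc zero))
next (suc (suc (suc zero))) = suc (suc (suc (suc zero)))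
next (suc (suc (suc (suc zero)))) = zero

prev : Fin 5 → Fin 5
prev zero = suc (suc (suc (suc zero)))
prev (suc zero) = zero
prev (suc (suc zero)) = suc zero
prev (suc (suc (suc zero))) = suc (suc zero)
prev (suc (suc (suc (suc zero)))) = suc (suc (suc zero))

K3Adj : Fin 3 → Fin 3 → Set
K3Adj i j = i ≢ j

p2p3E : Fin 5 → Fin 5 → Bool
p2p3E zero (suc zero) = true
p2p3E (suc (suc zero)) (suc (suc (suc zero))) = true
p2p3E (suc (suc (suc zero))) (suc (suc (suc (suc zero)))) = true
p2p3E _ _ = false

P2∪P3Adj : Fin 5 → Fin 5 → Set
P2∪P3Adj i j = T (p2p3E i j ∨ p2p3E j i)

C5Adj : Fin 5 → Fin 5 → Set
C5Adj i j = (j ≡ next i) ⊎ (i ≡ next j)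

module _ (G : Graph) where
  open Graph G

  InducedCopy : {m : ℕ} → (Fin m → Fin m → Set) → (Fin m → Fin n) → Set
  InducedCopy P f =
    (∀ i j → f i ≡ f j → i ≡ j) ×
    (∀ i j → Adj (f i) (f j) → P i j) ×
    (∀ i j → P i j → Adj (f i) (f j))

  HasInduced : {m : ℕ} → (Fin m → Fin m → Set) → Set
  HasInduced {m} P = Σ (Fin m → Fin n) (InducedCopy P)

  data Near (S : Fin n → Set) : ℕ → Fin n → Set where
    here  : ∀ {k x} → S x → Near S k x
    step  : ∀ {k x y} → Adj x y → Near S k y → Near S (suc k) x

  DistIs : (Fin n → Set) → ℕ → Fin n → Set
  DistIs S k x = Near S k x × (∀ m → m < k → ¬ Near S m x)

  Connected : Set
  Connected = ∀ x y → ∃ λ k → Near (λ z → z ≡ y) k x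

  -- Imperfect: some induced subgraph G[U] has chromatic number > clique number,
  -- i.e. there is k with every clique of G[U] of size ≤ k but G[U] not k-colourable.
  IsClique : Subset n → Set
  IsClique K = ∀ x y → x ∈ K → y ∈ K → x ≢ y → Adj x y

  Colourable : Subset n → ℕ → Set
  Colourable U k = Σ (Fin n → Fin k) λ c → ∀ x y → x ∈ U → y ∈ U → Adj x y → c x ≢ c y

  Imperfect : Set
  Imperfect = Σ (Subset n) λ U → Σ ℕ λ k →
    (∀ (K : Subset n) → (∀ x → x ∈ K → x ∈ U) → IsClique K → ∣ K ∣ ≤ k) ×
    ¬ Colourable U k

  module Setup (v : Fin 5 → Fin n) where
    S0 : Fin n → Set
    S0 x = ∃ λ j → x ≡ v j

    S : ℕ → Fin n → Set
    S k x = ¬ S0 x × DistIs S0 k x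

    B : Fin 5 → Fin n → Set
    B i x = S 1 x × Adj x (v (prev i)) × Adj x (v (next i)) ×
            (∀ j → Adj x (v j) → (j ≡ prev i) ⊎ (j ≡ next i))

    inB : Fin n → Set
    inB x = ∃ λ j → B j x

    Nonempty : (Fin n → Set) → Set
    Nonempty P = ∃ P

    hB≡ : ℕ → Set
    hB≡ h = Σ (Subset 5) λ T → (∣ T ∣ ≡ h) ×
              (∀ j → (j ∈ T → Nonempty (B j)) × (Nonempty (B j) → j ∈ T))

    AtMostOne : (Fin n → Set) → Set
    AtMostOne P = ∀ x y → P x → P y → x ≡ y

    -- N(P) ∩ S2 = {z}
    NbrS2Is : (Fin n → Set) → Fin n → Set
    NbrS2Is P z = ∀ y → ((S 2 y × ¬ P y × ∃ λ x → P x × Adj x y) → y ≡ z) ×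
                        (y ≡ z → (S 2 y × ¬ P y × ∃ λ x → P x × Adj x y))

    HasNbrInS2 : Fin n → Set
    HasNbrInS2 x = ∃ λ y → S 2 y × Adj x y

{-# OPTIONS --safe #-}
module Submission where

-- In a triangle-free graph with no induced P₂ ∪ P₃, no edge is anticomplete to an induced
-- P₃. Taking for the edge either zb with z ∈ S₂, b ∈ S₁, or a cycle edge v_{k+2}v_{k+3}, one
-- finds: vertices of A_j have no neighbour in S₂, so every vertex of S₂ sees some B_k; a
-- vertex of B_k has at most one neighbour in S₂ and distinct vertices of B_k have none in
-- common; and a neighbour z ∈ S₂ of some b ∈ B_i is adjacent to all of B_{i±2} and to every
-- vertex of B_{i±1} nonadjacent to b. As j ↦ j + 2 runs through all five indices, under the
-- hypotheses of (3) this adjacency spreads to every B_j, which leaves room for only one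
-- vertex in S₂.

open import Defs
open import Data.Nat using (zero; suc; z≤n; s≤s; _≤_; _<_)
open import Data.Nat.Properties using (allUpTo?; ≤-trans)
open import Data.Fin using (Fin; zero; suc)
open import Data.Fin.Patterns using (0F; 1F; 2F; 3F; 4F)
open import Data.Fin.Properties using (_≟_; any?; all?)
open import Data.Fin.Subset using (Subset; _∈_; ∣_∣; _-_)
open import Data.Fin.Subset.Properties using (x∈p∧x≢y⇒x∈p-y; x∈p⇒∣p-x∣<∣p∣)
open import Data.Product using (∃; _×_; _,_; proj₁; proj₂)
open import Data.Sum using (_⊎_; inj₁; inj₂)
open import Data.Empty using (⊥; ⊥-elim)
open import Data.Unit using (tt)
open import Function using (_∘_)
open import Relation.Nullary using (¬_; Dec; yes; no)
open import Relation.Nullary.Decidable using (T?; _×-dec_; _⊎-dec_; _→-dec_; ¬?; map′; from-yes; decidable-stable)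
open import Relation.Binary.PropositionalEquality using (_≡_; _≢_; refl; sym; subst)

next² : Fin 5 → Fin 5
next² i = next (next i)

next³ : Fin 5 → Fin 5
next³ i = next (next² i)

prev-next : ∀ i → prev (next i) ≡ i
prev-next = from-yes (all? λ i → prev (next i) ≟ i)

next-prev : ∀ i → next (prev i) ≡ i
next-prev = from-yes (all? λ i → next (prev i) ≟ i)

next³≡prev² : ∀ i → next³ i ≡ prev (prev i)
next³≡prev² = from-yes (all? λ i → next³ i ≟ prev (prev i))

next⁴≡prev : ∀ i → next² (next² i) ≡ prev i
next⁴≡prev = from-yes (all? λ i → next² (next² i) ≟ prev i)

next¹⁰≡id : ∀ i → next² (next² (next² (next² (next² i)))) ≡ i
next¹⁰≡id = from-yes (all? λ i → next² (next² (next² (next² (next² i)))) ≟ i)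

next²≢prev : ∀ i → next² i ≢ prev i
next²≢prev = from-yes (all? λ i → ¬? (next² i ≟ prev i))

next²≢next : ∀ i → next² i ≢ next i
next²≢next = from-yes (all? λ i → ¬? (next² i ≟ next i))

next³≢prev : ∀ i → next³ i ≢ prev i
next³≢prev = from-yes (all? λ i → ¬? (next³ i ≟ prev i))

next³≢next : ∀ i → next³ i ≢ next i
next³≢next = from-yes (all? λ i → ¬? (next³ i ≟ next i))

next²≢id : ∀ i → next² i ≢ i
next²≢id = from-yes (all? λ i → ¬? (next² i ≟ i))

next³≢id : ∀ i → next³ i ≢ i
next³≢id = from-yes (all? λ i → ¬? (next³ i ≟ i))

C5Adj? : ∀ i j → Dec (C5Adj i j)
C5Adj? i j = (j ≟ next i) ⊎-dec (i ≟ next j)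

cycle-cover : ∀ j m → m ≡ j ⊎ C5Adj m j ⊎ m ≡ next² j ⊎ m ≡ next³ j
cycle-cover = from-yes (all? λ j → all? λ m →
  (m ≟ j) ⊎-dec C5Adj? m j ⊎-dec (m ≟ next² j) ⊎-dec (m ≟ next³ j))

pentagram-cover : ∀ i k →
  k ≡ i ⊎ k ≡ next² i ⊎ k ≡ next² (next² i) ⊎ k ≡ next² (next² (next² i)) ⊎
  k ≡ next² (next² (next² (next² i)))
pentagram-cover = from-yes (all? λ i → all? λ k →
  (k ≟ i) ⊎-dec (k ≟ next² i) ⊎-dec (k ≟ next² (next² i)) ⊎-dec
  (k ≟ next² (next² (next² i))) ⊎-dec (k ≟ next² (next² (next² (next² i)))))

∣p∣≡2⇒p⊆⁅a,b⁆ : ∀ {n} {p : Subset n} {a b c} → ∣ p ∣ ≡ 2 →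
           a ∈ p → b ∈ p → a ≢ b → c ∈ p → c ≡ a ⊎ c ≡ b
∣p∣≡2⇒p⊆⁅a,b⁆ {p = p} {a} {b} {c} ∣p∣≡2 a∈p b∈p a≢b c∈p with c ≟ a | c ≟ b
... | yes c≡a | _       = inj₁ c≡a
... | no  _   | yes c≡b = inj₂ c≡b
... | no  c≢a | no  c≢b = ⊥-elim (3≰2 (subst (3 ≤_) ∣p∣≡2 3≤∣p∣))
  where
  3≰2 : ¬ 3 ≤ 2
  3≰2 (s≤s (s≤s ()))
  c∈p-a-b : c ∈ p - a - b
  c∈p-a-b = x∈p∧x≢y⇒x∈p-y (x∈p∧x≢y⇒x∈p-y c∈p c≢a) c≢b
  1≤∣p-a-b∣ : 1 ≤ ∣ p - a - b ∣
  1≤∣p-a-b∣ = ≤-trans (s≤s z≤n) (x∈p⇒∣p-x∣<∣p∣ c∈p-a-b)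
  2≤∣p-a∣ : 2 ≤ ∣ p - a ∣
  2≤∣p-a∣ = ≤-trans (s≤s 1≤∣p-a-b∣) (x∈p⇒∣p-x∣<∣p∣ (x∈p∧x≢y⇒x∈p-y b∈p (a≢b ∘ sym)))
  3≤∣p∣ : 3 ≤ ∣ p ∣
  3≤∣p∣ = ≤-trans (s≤s 2≤∣p-a∣) (x∈p⇒∣p-x∣<∣p∣ a∈p)

module Distance (G : Graph) where
  open Graph G

  near? : {S : Fin n → Set} → (∀ x → Dec (S x)) → ∀ k x → Dec (Near G S k x)
  near? S? k x with S? x
  near? S? k       x | yes x∈S = yes (here x∈S)
  near? S? zero    x | no  x∉S = no λ { (here x∈S) → x∉S x∈S }
  near? S? (suc k) x | no  x∉S with any? (λ y → adj? x y ×-dec near? S? k y)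
  ... | yes (_ , x~y , y-near) = yes (step x~y y-near)
  ... | no  ¬step = no λ { (here x∈S) → x∉S x∈S ; (step x~y y-near) → ¬step (_ , x~y , y-near) }

  distIs? : {S : Fin n → Set} → (∀ x → Dec (S x)) → ∀ k x → Dec (DistIs G S k x)
  distIs? S? k x = near? S? k x ×-dec
    map′ (λ far m m<k → far {m} m<k) (λ far {m} m<k → far m m<k) (allUpTo? (λ m → ¬? (near? S? m x)) k)

  distIs-1 : {S : Fin n → Set} {x y : Fin n} → ¬ S x → Adj x y → S y → DistIs G S 1 x
  distIs-1 {S} {x} x∉S x~y y∈S = step x~y (here y∈S) , not-near
    where
    not-near : ∀ m → m < 1 → ¬ Near G S m x
    not-near zero    _        (here x∈S) = x∉S x∈S
    not-near (suc _) (s≤s ())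

module TriangleFree (G : Graph) (K3-free : ¬ HasInduced G K3Adj) where
  open Graph G renaming (sym to Adj-sym)

  triangle-free : {x y z : Fin n} → Adj x y → Adj y z → ¬ Adj x z
  triangle-free {x} {y} {z} x~y y~z x~z = K3-free (f , injective , reflects , preserves)
    where
    f : Fin 3 → Fin n
    f 0F = x
    f 1F = y
    f 2F = z
    preserves : ∀ i j → K3Adj i j → Adj (f i) (f j)
    preserves 0F 0F i≢i = ⊥-elim (i≢i refl)
    preserves 0F 1F _   = x~y
    preserves 0F 2F _   = x~z
    preserves 1F 0F _   = Adj-sym x~y
    preserves 1F 1F i≢i = ⊥-elim (i≢i refl)
    preserves 1F 2F _   = y~z
    preserves 2F 0F _   = Adj-sym x~z
    preserves 2F 1F _   = Adj-sym y~z
    preserves 2F 2F i≢i = ⊥-elim (i≢i refl)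
    reflects : ∀ i j → Adj (f i) (f j) → K3Adj i j
    reflects i j fi~fj refl = irrefl fi~fj
    injective : ∀ i j → f i ≡ f j → i ≡ j
    injective i j fi≡fj = decidable-stable (i ≟ j) λ i≢j →
      irrefl (subst (λ t → Adj t (f j)) fi≡fj (preserves i j i≢j))

P2∪P3Adj? : ∀ i j → Dec (P2∪P3Adj i j)
P2∪P3Adj? i j = T? _

P2∪P3-neighbourhood-⊆ : ∀ i j → (∀ k → P2∪P3Adj i k → P2∪P3Adj j k) →
                        i ≡ j ⊎ (i ≡ 2F × j ≡ 4F) ⊎ (i ≡ 4F × j ≡ 2F)
P2∪P3-neighbourhood-⊆ = from-yes (all? λ i → all? λ j →
  all? (λ k → P2∪P3Adj? i k →-dec P2∪P3Adj? j k) →-dec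
  ((i ≟ j) ⊎-dec ((i ≟ 2F) ×-dec (j ≟ 4F)) ⊎-dec ((i ≟ 4F) ×-dec (j ≟ 2F))))

module P2∪P3Copy (G : Graph) {u w x y x' : Fin (Graph.n G)}
  (u~w : Graph.Adj G u w) (x~y : Graph.Adj G x y) (y~x' : Graph.Adj G y x')
  (x≢x' : x ≢ x') (x≁x' : ¬ Graph.Adj G x x')
  (u≁x : ¬ Graph.Adj G u x) (u≁y : ¬ Graph.Adj G u y) (u≁x' : ¬ Graph.Adj G u x')
  (w≁x : ¬ Graph.Adj G w x) (w≁y : ¬ Graph.Adj G w y) (w≁x' : ¬ Graph.Adj G w x') where
  open Graph G renaming (sym to Adj-sym)

  vertex : Fin 5 → Fin n
  vertex 0F = u
  vertex 1F = w
  vertex 2F = x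
  vertex 3F = y
  vertex 4F = x'

  preserves : ∀ i j → P2∪P3Adj i j → Adj (vertex i) (vertex j)
  preserves 0F 1F _ = u~w
  preserves 1F 0F _ = Adj-sym u~w
  preserves 2F 3F _ = x~y
  preserves 3F 2F _ = Adj-sym x~y
  preserves 3F 4F _ = y~x'
  preserves 4F 3F _ = Adj-sym y~x'
  preserves 0F 0F ()
  preserves 0F 2F ()
  preserves 0F 3F ()
  preserves 0F 4F ()
  preserves 1F 1F ()
  preserves 1F 2F ()
  preserves 1F 3F ()
  preserves 1F 4F ()
  preserves 2F 0F ()
  preserves 2F 1F ()
  preserves 2F 2F ()
  preserves 2F 4F ()
  preserves 3F 0F ()
  preserves 3F 1F ()
  preserves 3F 3F ()
  preserves 4F 0F ()
  preserves 4F 1F ()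
  preserves 4F 2F ()
  preserves 4F 4F ()

  reflects : ∀ i j → Adj (vertex i) (vertex j) → P2∪P3Adj i j
  reflects 0F 1F _ = tt
  reflects 1F 0F _ = tt
  reflects 2F 3F _ = tt
  reflects 3F 2F _ = tt
  reflects 3F 4F _ = tt
  reflects 4F 3F _ = tt
  reflects 0F 0F a = irrefl a
  reflects 1F 1F a = irrefl a
  reflects 2F 2F a = irrefl a
  reflects 3F 3F a = irrefl a
  reflects 4F 4F a = irrefl a
  reflects 0F 2F a = u≁x a
  reflects 0F 3F a = u≁y a
  reflects 0F 4F a = u≁x' a
  reflects 1F 2F a = w≁x a
  reflects 1F 3F a = w≁y a
  reflects 1F 4F a = w≁x' a
  reflects 2F 0F a = u≁x (Adj-sym a)
  reflects 3F 0F a = u≁y (Adj-sym a)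
  reflects 4F 0F a = u≁x' (Adj-sym a)
  reflects 2F 1F a = w≁x (Adj-sym a)
  reflects 3F 1F a = w≁y (Adj-sym a)
  reflects 4F 1F a = w≁x' (Adj-sym a)
  reflects 2F 4F a = x≁x' a
  reflects 4F 2F a = x≁x' (Adj-sym a)

  -- vertex i ≡ vertex j makes the neighbourhood of i in P2 ∪ P3 part of that of j,
  -- and the only such distinct pair, the ends of the P3, is kept apart by x ≢ x'.
  injective : ∀ i j → vertex i ≡ vertex j → i ≡ j
  injective i j i≡j with P2∪P3-neighbourhood-⊆ i j
    (λ k → reflects j k ∘ subst (λ t → Adj t (vertex k)) i≡j ∘ preserves i k)
  ... | inj₁ i≡j                  = i≡j
  ... | inj₂ (inj₁ (refl , refl)) = ⊥-elim (x≢x' i≡j)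
  ... | inj₂ (inj₂ (refl , refl)) = ⊥-elim (x≢x' (sym i≡j))

  induced : InducedCopy G P2∪P3Adj vertex
  induced = injective , reflects , preserves

module P2∪P3Free (G : Graph) (K3-free : ¬ HasInduced G K3Adj) (P2∪P3-free : ¬ HasInduced G P2∪P3Adj) where
  open Graph G
  open TriangleFree G K3-free

  edge-anticomplete-to-P₃-impossible : {u w x y x' : Fin n} →
    Adj u w → Adj x y → Adj y x' → x ≢ x' →
    ¬ Adj u x → ¬ Adj u y → ¬ Adj u x' → ¬ Adj w x → ¬ Adj w y → ¬ Adj w x' → ⊥
  edge-anticomplete-to-P₃-impossible u~w x~y y~x' x≢x' u≁x u≁y u≁x' w≁x w≁y w≁x' =
    P2∪P3-free (_ , P2∪P3Copy.induced G u~w x~y y~x' x≢x' (triangle-free x~y y~x')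
                                      u≁x u≁y u≁x' w≁x w≁y w≁x')

module AroundInducedC5
  (G : Graph) (K3-free : ¬ HasInduced G K3Adj) (P2∪P3-free : ¬ HasInduced G P2∪P3Adj)
  (v : Fin 5 → Fin (Graph.n G)) (c5 : InducedCopy G C5Adj v) where
  open Graph G renaming (sym to Adj-sym)
  open Setup G v
  open Distance G
  open TriangleFree G K3-free
  open P2∪P3Free G K3-free P2∪P3-free

  private
    variable
      i j k m : Fin 5
      a b b' x z z' : Fin n

  v-injective : v i ≡ v j → i ≡ j
  v-injective = proj₁ c5 _ _

  v-adj : C5Adj i j → Adj (v i) (v j)
  v-adj = proj₂ (proj₂ c5) _ _

  v-edge : ∀ i → Adj (v i) (v (next i))
  v-edge i = v-adj (inj₁ refl)

  S0? : ∀ x → Dec (S0 x)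
  S0? x = any? λ j → x ≟ v j

  S? : ∀ k x → Dec (S k x)
  S? k x = ¬? (S0? x) ×-dec distIs? S0? k x

  1<2 : 1 < 2
  1<2 = s≤s (s≤s z≤n)

  S₂-≁-S₀ : S 2 z → ¬ Adj z (v j)
  S₂-≁-S₀ (_ , _ , far) z~v = far 1 1<2 (step z~v (here (_ , refl)))

  S₁⇒¬S₂ : S 1 x → ¬ S 2 x
  S₁⇒¬S₂ (_ , near₁ , _) (_ , _ , far) = far 1 1<2 near₁

  S₂-has-S₁-neighbour : S 2 z → ∃ λ a → Adj z a × ∃ λ j → S 1 a × Adj a (v j)
  S₂-has-S₁-neighbour (z∉S₀ , here z∈S₀ , _) = ⊥-elim (z∉S₀ z∈S₀)
  S₂-has-S₁-neighbour (_ , step z~a (here a∈S₀) , far) = ⊥-elim (far 1 1<2 (step z~a (here a∈S₀)))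
  S₂-has-S₁-neighbour (_ , step {y = a} z~a (step a~w (here (j , refl))) , far) =
    a , z~a , j , (a∉S₀ , distIs-1 a∉S₀ a~w (j , refl)) , a~w
    where
    a∉S₀ : ¬ S0 a
    a∉S₀ a∈S₀ = far 1 1<2 (step z~a (here a∈S₀))

  A : Fin 5 → Fin n → Set
  A i x = S 1 x × Adj x (v i) × (∀ j → Adj x (v j) → j ≡ i)

  cycle-neighbours-nonconsecutive : Adj a (v j) → Adj a (v m) → m ≡ j ⊎ m ≡ next² j ⊎ m ≡ next³ j
  cycle-neighbours-nonconsecutive {j = j} {m} a~vj a~vm with cycle-cover j m
  ... | inj₁ m≡j                = inj₁ m≡j
  ... | inj₂ (inj₁ m~j)         = ⊥-elim (triangle-free a~vm (v-adj m~j) a~vj)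
  ... | inj₂ (inj₂ m≡j+2or3)    = inj₂ m≡j+2or3

  S₁-classification : S 1 a → Adj a (v j) → A j a ⊎ B (next j) a ⊎ B (prev j) a
  S₁-classification {a} {j} a∈S₁ a~vj
    with adj? a (v (next² j)) | adj? a (v (prev (prev j)))
  ... | yes a~v₊₂ | _ =
    inj₂ (inj₁ (a∈S₁ , subst (Adj a ∘ v) (sym (prev-next j)) a~vj , a~v₊₂ , only))
    where
    only : ∀ m → Adj a (v m) → m ≡ prev (next j) ⊎ m ≡ next² j
    only m a~vm with cycle-neighbours-nonconsecutive a~vj a~vm
    ... | inj₁ refl                = inj₁ (sym (prev-next j))
    ... | inj₂ (inj₁ m≡j+2)        = inj₂ m≡j+2
    ... | inj₂ (inj₂ refl)         = ⊥-elim (triangle-free a~v₊₂ (v-edge (next² j)) a~vm)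
  ... | no a≁v₊₂ | yes a~v₋₂ =
    inj₂ (inj₂ (a∈S₁ , a~v₋₂ , subst (Adj a ∘ v) (sym (next-prev j)) a~vj , only))
    where
    only : ∀ m → Adj a (v m) → m ≡ prev (prev j) ⊎ m ≡ next (prev j)
    only m a~vm with cycle-neighbours-nonconsecutive a~vj a~vm
    ... | inj₁ refl                = inj₂ (sym (next-prev j))
    ... | inj₂ (inj₁ refl)         = ⊥-elim (a≁v₊₂ a~vm)
    ... | inj₂ (inj₂ refl)         = inj₁ (next³≡prev² j)
  ... | no a≁v₊₂ | no a≁v₋₂ = inj₁ (a∈S₁ , a~vj , only)
    where
    only : ∀ m → Adj a (v m) → m ≡ j
    only m a~vm with cycle-neighbours-nonconsecutive a~vj a~vm
    ... | inj₁ m≡j                 = m≡j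
    ... | inj₂ (inj₁ refl)         = ⊥-elim (a≁v₊₂ a~vm)
    ... | inj₂ (inj₂ refl)         = ⊥-elim (a≁v₋₂ (subst (Adj a ∘ v) (next³≡prev² j) a~vm))

  A-≁-S₂ : A j a → S 2 z → ¬ Adj a z
  A-≁-S₂ {j} (_ , a~vj , only) z∈S₂ a~z =
    edge-anticomplete-to-P₃-impossible (Adj-sym a~z) (v-edge (next j)) (v-edge (next² j))
      (next³≢next j ∘ sym ∘ v-injective)
      (S₂-≁-S₀ z∈S₂) (S₂-≁-S₀ z∈S₂) (S₂-≁-S₀ z∈S₂)
      (triangle-free a~vj (v-edge j)) (next²≢id j ∘ only _) (next³≢id j ∘ only _)

  S₂-adj-B : S 2 z → ∃ λ k → ∃ λ b → B k b × Adj b z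
  S₂-adj-B z∈S₂ with S₂-has-S₁-neighbour z∈S₂
  ... | a , z~a , j , a∈S₁ , a~vj with S₁-classification a∈S₁ a~vj
  ...   | inj₁ a∈A        = ⊥-elim (A-≁-S₂ a∈A z∈S₂ (Adj-sym z~a))
  ...   | inj₂ (inj₁ a∈B) = next j , a , a∈B , Adj-sym z~a
  ...   | inj₂ (inj₂ a∈B) = prev j , a , a∈B , Adj-sym z~a

  B-∉S₀ : B k b → ¬ S0 b
  B-∉S₀ ((b∉S₀ , _) , _) = b∉S₀

  B-adj-prev : B k b → Adj b (v (prev k))
  B-adj-prev (_ , b~v₋₁ , _ , _) = b~v₋₁

  B-adj-next : B k b → Adj b (v (next k))
  B-adj-next (_ , _ , b~v₊₁ , _) = b~v₊₁

  B-≁ : B k b → j ≢ prev k → j ≢ next k → ¬ Adj b (v j)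
  B-≁ (_ , _ , _ , only) j≢k-1 j≢k+1 b~vj with only _ b~vj
  ... | inj₁ j≡k-1 = j≢k-1 j≡k-1
  ... | inj₂ j≡k+1 = j≢k+1 j≡k+1

  B-≁-next² : B k b → ¬ Adj b (v (next² k))
  B-≁-next² {k} b∈B = B-≁ b∈B (next²≢prev k) (next²≢next k)

  B-≁-next³ : B k b → ¬ Adj b (v (next³ k))
  B-≁-next³ {k} b∈B = B-≁ b∈B (next³≢prev k) (next³≢next k)

  B-≁-B-next² : B k b → B (next² k) b' → ¬ Adj b b'
  B-≁-B-next² {k} b∈B b'∈B b~b' =
    triangle-free b~b' (subst (Adj _ ∘ v) (prev-next (next k)) (B-adj-prev b'∈B)) (B-adj-next b∈B)

  S₂-neighbour-spreads : {c d : Fin 5} → S 2 z → Adj b z → ¬ Adj b b' → ¬ S0 b' →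
    Adj b' (v c) → Adj (v c) (v d) → ¬ Adj b (v c) → ¬ Adj b (v d) → Adj b' z
  S₂-neighbour-spreads z∈S₂ b~z b≁b' b'∉S₀ b'~vc vc~vd b≁vc b≁vd =
    decidable-stable (adj? _ _) λ b'≁z →
      edge-anticomplete-to-P₃-impossible (Adj-sym b~z) b'~vc vc~vd (λ b'≡vd → b'∉S₀ (_ , b'≡vd))
        (b'≁z ∘ Adj-sym) (S₂-≁-S₀ z∈S₂) (S₂-≁-S₀ z∈S₂) b≁b' b≁vc b≁vd

  B-next²-shares-S₂-neighbour : B i b → B (next² i) b' → S 2 z → Adj b z → Adj b' z
  B-next²-shares-S₂-neighbour {i} b∈B b'∈B z∈S₂ b~z =
    S₂-neighbour-spreads z∈S₂ b~z (B-≁-B-next² b∈B b'∈B) (B-∉S₀ b'∈B)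
      (B-adj-next b'∈B) (Adj-sym (v-edge (next² i))) (B-≁-next³ b∈B) (B-≁-next² b∈B)

  B-prev²-shares-S₂-neighbour : B i b → B (next² i) b' → S 2 z → Adj b' z → Adj b z
  B-prev²-shares-S₂-neighbour {i} b∈B b'∈B z∈S₂ b'~z =
    S₂-neighbour-spreads z∈S₂ b'~z (B-≁-B-next² b∈B b'∈B ∘ Adj-sym) (B-∉S₀ b∈B)
      (subst (Adj _ ∘ v) (sym (next⁴≡prev i)) (B-adj-prev b∈B)) (v-edge (next² (next² i)))
      (B-≁-next² b'∈B) (B-≁-next³ b'∈B)

  B-next-shares-S₂-neighbour : B i b → B (next i) b' → ¬ Adj b b' → S 2 z → Adj b z → Adj b' z
  B-next-shares-S₂-neighbour {i} b∈B b'∈B b≁b' z∈S₂ b~z =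
    S₂-neighbour-spreads z∈S₂ b~z b≁b' (B-∉S₀ b'∈B)
      (B-adj-next b'∈B) (v-edge (next² i)) (B-≁-next² b∈B) (B-≁-next³ b∈B)

  B-prev-shares-S₂-neighbour : B i b → B (next i) b' → ¬ Adj b b' → S 2 z → Adj b' z → Adj b z
  B-prev-shares-S₂-neighbour {i} b∈B b'∈B b≁b' z∈S₂ b'~z =
    S₂-neighbour-spreads z∈S₂ b'~z (b≁b' ∘ Adj-sym) (B-∉S₀ b∈B)
      (subst (Adj _ ∘ v) (sym (next⁴≡prev i)) (B-adj-prev b∈B)) (Adj-sym (v-edge (next³ i)))
      (B-≁-next³ b'∈B) (B-≁-next² b'∈B)

  S₂-neighbour-unique : B k b → S 2 z → S 2 z' → Adj b z → Adj b z' → z ≡ z'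
  S₂-neighbour-unique {k} b∈B z∈S₂ z'∈S₂ b~z b~z' = decidable-stable (_ ≟ _) λ z≢z' →
    edge-anticomplete-to-P₃-impossible (v-edge (next² k)) (Adj-sym b~z) b~z' z≢z'
      (S₂-≁-S₀ z∈S₂ ∘ Adj-sym) (B-≁-next² b∈B ∘ Adj-sym) (S₂-≁-S₀ z'∈S₂ ∘ Adj-sym)
      (S₂-≁-S₀ z∈S₂ ∘ Adj-sym) (B-≁-next³ b∈B ∘ Adj-sym) (S₂-≁-S₀ z'∈S₂ ∘ Adj-sym)

  B-neighbour-unique : B k b → B k b' → S 2 z → Adj b z → Adj b' z → b ≡ b'
  B-neighbour-unique {k} b∈B b'∈B z∈S₂ b~z b'~z = decidable-stable (_ ≟ _) λ b≢b' →
    edge-anticomplete-to-P₃-impossible (v-edge (next² k)) b~z (Adj-sym b'~z) b≢b'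
      (B-≁-next² b∈B ∘ Adj-sym) (S₂-≁-S₀ z∈S₂ ∘ Adj-sym) (B-≁-next² b'∈B ∘ Adj-sym)
      (B-≁-next³ b∈B ∘ Adj-sym) (S₂-≁-S₀ z∈S₂ ∘ Adj-sym) (B-≁-next³ b'∈B ∘ Adj-sym)

  NbrS2Is-intro : {P : Fin n → Set} → (∀ {x} → P x → ∃ λ k → B k x) →
    S 2 z → Nonempty P → (∀ {x} → P x → Adj x z) → NbrS2Is P z
  NbrS2Is-intro {z} {P} P⊆B z∈S₂ (x₀ , x₀∈P) P~z y =
    is-z , λ { refl → z∈S₂ , z∉P , x₀ , x₀∈P , P~z x₀∈P }
    where
    is-z : S 2 y × ¬ P y × (∃ λ x → P x × Adj x y) → y ≡ z
    is-z (y∈S₂ , _ , x , x∈P , x~y) = S₂-neighbour-unique (proj₂ (P⊆B x∈P)) y∈S₂ z∈S₂ x~y (P~z x∈P)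
    z∉P : ¬ P z
    z∉P z∈P = S₁⇒¬S₂ (proj₁ (proj₂ (P⊆B z∈P))) z∈S₂

  AdjToSome AdjToAll : Fin n → Fin 5 → Set
  AdjToSome z k = ∃ λ b → B k b × Adj b z
  AdjToAll  z k = ∀ {b} → B k b → Adj b z

  adjToSome⇒adjToAll-next² : S 2 z → AdjToSome z k → AdjToAll z (next² k)
  adjToSome⇒adjToAll-next² z∈S₂ (_ , b∈B , b~z) b'∈B = B-next²-shares-S₂-neighbour b∈B b'∈B z∈S₂ b~z

  adjToSome-next²⇒adjToAll : S 2 z → AdjToSome z (next² k) → AdjToAll z k
  adjToSome-next²⇒adjToAll z∈S₂ (_ , b'∈B , b'~z) b∈B = B-prev²-shares-S₂-neighbour b∈B b'∈B z∈S₂ b'~z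

  adjToAll⇒adjToSome : Nonempty (B k) → AdjToAll z k → AdjToSome z k
  adjToAll⇒adjToSome (b , b∈B) all = b , b∈B , all b∈B

  adjToAll⇒atMostOne : S 2 z → AdjToAll z k → AtMostOne (B k)
  adjToAll⇒atMostOne z∈S₂ all _ _ b∈B b'∈B = B-neighbour-unique b∈B b'∈B z∈S₂ (all b∈B) (all b'∈B)

  adjToAll-pair : S 2 z → Nonempty (B k) → Nonempty (B (next² k)) →
    (∃ λ x → (B k x ⊎ B (next² k) x) × Adj x z) → AdjToAll z k × AdjToAll z (next² k)
  adjToAll-pair {z} {k} z∈S₂ ne ne' (x , inj₁ x∈B , x~z) = all , all'
    where
    all' : AdjToAll z (next² k)
    all' = adjToSome⇒adjToAll-next² z∈S₂ (x , x∈B , x~z)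
    all : AdjToAll z k
    all = adjToSome-next²⇒adjToAll z∈S₂ (adjToAll⇒adjToSome ne' all')
  adjToAll-pair {z} {k} z∈S₂ ne ne' (x , inj₂ x∈B' , x~z) = all , all'
    where
    all : AdjToAll z k
    all = adjToSome-next²⇒adjToAll z∈S₂ (x , x∈B' , x~z)
    all' : AdjToAll z (next² k)
    all' = adjToSome⇒adjToAll-next² z∈S₂ (adjToAll⇒adjToSome ne all)

  B-next²-S₂-neighbourhood : Nonempty (B i) → Nonempty (B (next² i)) →
    (∃ λ x → ∃ λ y → (B i x ⊎ B (next² i) x) × S 2 y × Adj x y) →
    AtMostOne (B i) × AtMostOne (B (next² i)) ×
    (∃ λ z → S 2 z × NbrS2Is (B i) z × NbrS2Is (B (next² i)) z)
  B-next²-S₂-neighbourhood ne ne' (x , y , x∈B , y∈S₂ , x~y)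
    with adjToAll-pair y∈S₂ ne ne' (x , x∈B , x~y)
  ... | all , all' =
    adjToAll⇒atMostOne y∈S₂ all , adjToAll⇒atMostOne y∈S₂ all' ,
    y , y∈S₂ , NbrS2Is-intro (_ ,_) y∈S₂ ne all , NbrS2Is-intro (_ ,_) y∈S₂ ne' all'

  NbrS2Is-singleton : B k b → S 2 z → Adj b z → NbrS2Is (_≡ b) z
  NbrS2Is-singleton b∈B z∈S₂ b~z =
    NbrS2Is-intro (λ { refl → _ , b∈B }) z∈S₂ (_ , refl) (λ { refl → b~z })

  B-next-nonadjacent-S₂-neighbourhood : B i b → B (next i) b' → ¬ Adj b b' →
    (¬ HasNbrInS2 b × ¬ HasNbrInS2 b') ⊎
    (∃ λ z → S 2 z × NbrS2Is (_≡ b) z × NbrS2Is (_≡ b') z)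
  B-next-nonadjacent-S₂-neighbourhood {b = b} {b'} b∈B b'∈B b≁b'
    with any? (λ z → S? 2 z ×-dec adj? b z) | any? (λ z → S? 2 z ×-dec adj? b' z)
  ... | yes (z , z∈S₂ , b~z) | _ =
    inj₂ (z , z∈S₂ , NbrS2Is-singleton b∈B z∈S₂ b~z ,
          NbrS2Is-singleton b'∈B z∈S₂ (B-next-shares-S₂-neighbour b∈B b'∈B b≁b' z∈S₂ b~z))
  ... | no _ | yes (z , z∈S₂ , b'~z) =
    inj₂ (z , z∈S₂ , NbrS2Is-singleton b∈B z∈S₂ (B-prev-shares-S₂-neighbour b∈B b'∈B b≁b' z∈S₂ b'~z) ,
          NbrS2Is-singleton b'∈B z∈S₂ b'~z)
  ... | no b-isolated | no b'-isolated = inj₁ (b-isolated , b'-isolated)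

  adjToAll-from-three : S 2 z →
    Nonempty (B i) → Nonempty (B (next² i)) → Nonempty (B (next² (next² i))) → ∀ j → AdjToAll z j
  adjToAll-from-three {z} {i} z∈S₂ ne₀ ne₁ ne₂ = everywhere
    where
    forward : AdjToSome z k → AdjToAll z (next² k)
    forward = adjToSome⇒adjToAll-next² z∈S₂
    backward : AdjToSome z (next² k) → AdjToAll z k
    backward = adjToSome-next²⇒adjToAll z∈S₂
    some : Nonempty (B k) → AdjToAll z k → AdjToSome z k
    some = adjToAll⇒adjToSome
    wrap : next² (next² (next² (next² (next² i)))) ≡ i
    wrap = next¹⁰≡id i
    -- Wherever N(z) meets some B_k, steps j ↦ j ± 2 through the nonempty B_i, B_{i+2}, B_{i+4}
    -- lead to the middle one.
    hub : AdjToSome z (next² i)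
    hub with S₂-adj-B z∈S₂
    ... | k , b , b∈B , b~z with pentagram-cover i k
    ... | inj₁ refl                      = some ne₁ (forward (b , b∈B , b~z))
    ... | inj₂ (inj₁ refl)               = b , b∈B , b~z
    ... | inj₂ (inj₂ (inj₁ refl))        = some ne₁ (backward (b , b∈B , b~z))
    ... | inj₂ (inj₂ (inj₂ (inj₁ refl))) = some ne₁ (backward (some ne₂ (backward (b , b∈B , b~z))))
    ... | inj₂ (inj₂ (inj₂ (inj₂ refl))) =
      some ne₁ (forward (some ne₀ (subst (AdjToAll z) wrap (forward (b , b∈B , b~z)))))
    all₀ : AdjToAll z i
    all₀ = backward hub
    all₁ : AdjToAll z (next² i)
    all₁ = forward (some ne₀ all₀)
    all₂ : AdjToAll z (next² (next² i))
    all₂ = forward hub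
    all₃ : AdjToAll z (next² (next² (next² i)))
    all₃ = forward (some ne₂ all₂)
    all₄ : AdjToAll z (next² (next² (next² (next² i))))
    all₄ = backward (subst (AdjToSome z) (sym wrap) (some ne₀ all₀))
    everywhere : ∀ j → AdjToAll z j
    everywhere j with pentagram-cover i j
    ... | inj₁ refl                      = all₀
    ... | inj₂ (inj₁ refl)               = all₁
    ... | inj₂ (inj₂ (inj₁ refl))        = all₂
    ... | inj₂ (inj₂ (inj₂ (inj₁ refl))) = all₃
    ... | inj₂ (inj₂ (inj₂ (inj₂ refl))) = all₄

  adjToAll-from-two : S 2 z → hB≡ 2 → Nonempty (B i) → Nonempty (B (next² i)) → ∀ j → AdjToAll z j
  adjToAll-from-two {z} {i} z∈S₂ (T , ∣T∣≡2 , T≡nonempty) ne ne' = everywhere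
    where
    i-or-next² : Nonempty (B j) → j ≡ i ⊎ j ≡ next² i
    i-or-next² ne-j = ∣p∣≡2⇒p⊆⁅a,b⁆ ∣T∣≡2 (proj₂ (T≡nonempty _) ne) (proj₂ (T≡nonempty _) ne')
                        (next²≢id i ∘ sym) (proj₂ (T≡nonempty _) ne-j)
    pair : AdjToAll z i × AdjToAll z (next² i)
    pair with S₂-adj-B z∈S₂
    ... | _ , b , b∈B , b~z with i-or-next² (b , b∈B)
    ...   | inj₁ refl = adjToAll-pair z∈S₂ ne ne' (b , inj₁ b∈B , b~z)
    ...   | inj₂ refl = adjToAll-pair z∈S₂ ne ne' (b , inj₂ b∈B , b~z)
    everywhere : ∀ j → AdjToAll z j
    everywhere j b∈B with i-or-next² (_ , b∈B)
    ... | inj₁ refl = proj₁ pair b∈B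
    ... | inj₂ refl = proj₂ pair b∈B

  adjToAll-everywhere⇒S₂-singleton : S 2 z → (∀ j → AdjToAll z j) →
    (∀ j → AtMostOne (B j)) × (∀ x y → inB x → inB y → ¬ Adj x y) ×
    (∃ λ z → (∀ y → (S 2 y → y ≡ z) × (y ≡ z → S 2 y)) × (∀ x → inB x → Adj x z))
  adjToAll-everywhere⇒S₂-singleton {z} z∈S₂ all =
    (λ j → adjToAll⇒atMostOne z∈S₂ (all j)) ,
    (λ { _ _ (j , x∈B) (k , y∈B) x~y → triangle-free x~y (all k y∈B) (all j x∈B) }) ,
    z , (λ y → S₂-is-z y , λ { refl → z∈S₂ }) , (λ { _ (j , x∈B) → all j x∈B })
    where
    S₂-is-z : ∀ y → S 2 y → y ≡ z
    S₂-is-z y y∈S₂ with S₂-adj-B y∈S₂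
    ... | k , b , b∈B , b~y = S₂-neighbour-unique b∈B y∈S₂ z∈S₂ b~y (all k b∈B)

lemma3p4 : (G : Graph) → let open Graph G in
    Connected G → Imperfect G →
    ¬ HasInduced G K3Adj → ¬ HasInduced G P2∪P3Adj →
    (v : Fin 5 → Fin n) → InducedCopy G C5Adj v →
    let open Setup G v in
    (∃ λ y → S 2 y) →
    -- (1)
    (∀ i → Nonempty (B i) → Nonempty (B (next (next i))) →
       (∃ λ x → ∃ λ y → (B i x ⊎ B (next (next i)) x) × S 2 y × Adj x y) →
       AtMostOne (B i) × AtMostOne (B (next (next i))) ×
       (∃ λ z → S 2 z × NbrS2Is (B i) z × NbrS2Is (B (next (next i))) z))
    ×
    -- (2)
    (∀ i b b' → B i b → B (next i) b' → ¬ Adj b b' →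
       (¬ HasNbrInS2 b × ¬ HasNbrInS2 b') ⊎
       (∃ λ z → S 2 z × NbrS2Is (λ x → x ≡ b) z × NbrS2Is (λ x → x ≡ b') z))
    ×
    -- (3)
    ((∃ λ i → (hB≡ 2 × Nonempty (B i) × Nonempty (B (next (next i)))) ⊎
              (Nonempty (B (prev i)) × Nonempty (B i) × Nonempty (B (next (next i))))) →
       (∀ j → AtMostOne (B j)) ×
       (∀ x y → inB x → inB y → ¬ Adj x y) ×
       (∃ λ z → (∀ y → (S 2 y → y ≡ z) × (y ≡ z → S 2 y)) ×
                (∀ x → inB x → Adj x z)))
lemma3p4 G _ _ K3-free P2∪P3-free v c5 (s , s∈S₂) =
  (λ _ → B-next²-S₂-neighbourhood) ,
  (λ _ _ _ → B-next-nonadjacent-S₂-neighbourhood) ,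
  λ { (_ , inj₁ (h=2 , ne₀ , ne₂)) →
        adjToAll-everywhere⇒S₂-singleton s∈S₂ (adjToAll-from-two s∈S₂ h=2 ne₀ ne₂)
    ; (i , inj₂ (ne₋₁ , ne₀ , ne₂)) →
        adjToAll-everywhere⇒S₂-singleton s∈S₂
          (adjToAll-from-three s∈S₂ ne₀ ne₂ (subst (Nonempty ∘ B) (sym (next⁴≡prev i)) ne₋₁)) }
  where
  open Setup G v
  open AroundInducedC5 G K3-free P2∪P3-free v c5
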